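{- For every $d\ge1$ and every degree-$d$ polynomial threshold function $f:\{1,-1\}^n\to\{1,-1\}$ (i.e. $f=\mathrm{sign}(P)$ for a real polynomial $P$ of degree at most $d$), $\mathbb{AS}(f)\le 3\,n^{1-2^{ -d}}$.
   Context: $\mathbb{AS}(f)=\sum_{i=1}^n\Pr[f(X)\neq f(X^{(i)})]$ where $X$ is uniform on $\{1,-1\}^n$ and $X^{(i)}$ is $X$ with coordinate $i$ negated. The sign function maps reals to $\{1,-1\}$ with some fixed convention at $0$.
   Formalization: The polynomial $P$ defining the threshold function has rational coefficients instead of real ones. -}

module Defs where

open import Data.Bool using (Bool; true; false; not; if_then_else_; _xor_)
open import Data.Nat as ℕ using (ℕ; zero; suc)
open import Data.Fin using (Fin)
open import Data.Vec using (Vec; []; _∷_; lookup; updateAt)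
open import Data.List using (List; []; _∷_; map; _++_; length; allFin; foldr)
open import Data.Nat.ListAction using (sum)
open import Data.List.Relation.Unary.All using (All)
open import Data.Product using (_×_; _,_; proj₁; proj₂)
open import Data.Rational using (ℚ; 0ℚ; 1ℚ; _+_; _*_; -_)
open import Data.Rational.Properties using (_<?_; _≟_)
open import Relation.Nullary.Decidable using (⌊_⌋)

-- A point of the Boolean cube {1,-1}^n: true encodes 1, false encodes -1.
Cube : ℕ → Set
Cube n = Vec Bool n

pm : Bool → ℚ
pm true  = 1ℚ
pm false = - 1ℚ

allCube : (n : ℕ) → List (Cube n)
allCube zero    = [] ∷ []
allCube (suc n) = map (true ∷_) (allCube n) ++ map (false ∷_) (allCube n)

flipAt : ∀ {n} → Cube n → Fin n → Cube n
flipAt x i = updateAt x i not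

-- A monomial is a list of variable indices (repetitions allowed);
-- its degree is its length.
Monomial : ℕ → Set
Monomial n = List (Fin n)

Poly : ℕ → Set
Poly n = List (ℚ × Monomial n)

DegreeAtMost : ∀ {n} → ℕ → Poly n → Set
DegreeAtMost d P = All (λ t → length (proj₂ t) ℕ.≤ d) P

evalMono : ∀ {n} → Monomial n → Cube n → ℚ
evalMono m x = foldr (λ i acc → pm (lookup x i) * acc) 1ℚ m

evalPoly : ∀ {n} → Poly n → Cube n → ℚ
evalPoly P x = foldr (λ t acc → proj₁ t * evalMono (proj₂ t) x + acc) 0ℚ P

-- sign with convention b at 0 (true = 1, false = -1).
sgn : Bool → ℚ → Bool
sgn b q = if ⌊ 0ℚ <? q ⌋ then true else (if ⌊ q ≟ 0ℚ ⌋ then b else false)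

ptf : ∀ {n} → Bool → Poly n → Cube n → Bool
ptf b P x = sgn b (evalPoly P x)

-- Number of pairs (x, i) with f(x) ≠ f(x^{(i)}); AS(f) = sensCount f / 2^n.
sensCount : ∀ {n} → (Cube n → Bool) → ℕ
sensCount {n} f =
  sum (map (λ x → sum (map (λ i → if f x xor f (flipAt x i) then 1 else 0) (allFin n)))
           (allCube n))

{-# OPTIONS --safe #-}
-- Write f = sgn q and gᵢ = sgn ∂ᵢq, where ∂ᵢq = q(x, xᵢ = 1) − q(x, xᵢ = −1) has degree d − 1 and does
-- not depend on xᵢ. On every edge in direction i along which f changes, gᵢ is the value of f at the
-- endpoint with xᵢ = 1; hence the number S(f) of sensitive pairs (x, i) equals Σₓ f(x) A(x) with
-- A(x) = Σᵢ xᵢ gᵢ(x). By Cauchy–Schwarz S(f)² ≤ 2ⁿ Σₓ A(x)². Expanding A², the diagonal terms give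
-- n·2ⁿ, and since xᵢ and gⱼ do not depend on xⱼ, pairing x with its neighbour in direction j bounds
-- Σₓ xᵢgᵢ(x)xⱼgⱼ(x) by the number of edges in direction j on which gᵢ changes. So
-- S(f)² ≤ 2ⁿ (n·2ⁿ + Σᵢ S(gᵢ)), and induction on d, raising to the power 2^(d−1), gives the bound.

module Submission where

open import Defs
open import Data.Bool using (Bool; true; false; not; if_then_else_; _xor_)
open import Data.Bool.Properties using (xor-comm; xor-same)
open import Data.Fin as Fin using (Fin)
open import Data.Integer as ℤ using (ℤ; +_; 0ℤ; 1ℤ; -1ℤ)
open import Data.Integer.Properties as ℤ using ()
open import Data.Integer.Tactic.RingSolver using (solve-∀)
open import Data.List using (List; []; _∷_; length; map; _++_; allFin)
open import Data.List.Properties using (length-++; length-map; length-tabulate; map-tabulate)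
open import Data.List.Relation.Unary.All as All using (All; []; _∷_)
import Data.List.Relation.Unary.All.Properties as All
open import Data.Nat as ℕ using (ℕ; zero; suc; z≤n; s≤s; _+_; _*_; _^_; _∸_; _≤_; _⊔_)
open import Data.Nat.ListAction using (sum)
open import Data.Nat.Properties as ℕ using ()
import Data.Nat.Tactic.RingSolver as ℕ
open import Data.List.Extrema ℕ.≤-totalOrder using (max; xs≤max; argmax-sel)
open import Data.Product using (_,_; _×_)
open import Data.Rational as ℚ using (ℚ; 0ℚ; 1ℚ)
open import Data.Rational.Properties as ℚ using ()
open import Data.Rational.Solver using (module +-*-Solver)
open import Data.Sum using (_⊎_; inj₁; inj₂)
open import Data.Vec using (_∷_; lookup; _[_]≔_)
open import Data.Vec.Properties
  using ( updateAt-updateAt; updateAt-cong-local; lookup∘updateAt; lookup∘updateAt′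
        ; []≔-lookup; []≔-idempotent; []≔-commutes; lookup∘update; lookup∘update′)
open import Function using (_∘_; const; id)
open import Relation.Binary using (tri<; tri≈; tri>)
open import Relation.Binary.PropositionalEquality
open import Relation.Nullary using (yes; no; contradiction)

-- Only signs of derivatives matter below, so ∂ omits the usual factor 1/2.
∂ : ∀ {n} → Fin n → (Cube n → ℚ) → Cube n → ℚ
∂ i q x = q (x [ i ]≔ true) ℚ.- q (x [ i ]≔ false)

HasDegree≤ : ∀ {n} → ℕ → (Cube n → ℚ) → Set
HasDegree≤ zero    q = ∀ x y → q x ≡ q y
HasDegree≤ (suc d) q = ∀ i → HasDegree≤ d (∂ i q)

module _ {n : ℕ} where

  ∂-cong : ∀ (i : Fin n) {q r : Cube n → ℚ} → q ≗ r → ∂ i q ≗ ∂ i r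
  ∂-cong i q≗r x = cong₂ ℚ._-_ (q≗r _) (q≗r _)

  ∂-const : ∀ (i : Fin n) {q : Cube n → ℚ} → HasDegree≤ zero q → ∂ i q ≗ const 0ℚ
  ∂-const i {q} q-const x = begin
    q (x [ i ]≔ true) ℚ.- q (x [ i ]≔ false) ≡⟨ cong (λ t → q (x [ i ]≔ true) ℚ.- t) (q-const _ _) ⟨
    q (x [ i ]≔ true) ℚ.- q (x [ i ]≔ true)  ≡⟨ ℚ.+-inverseʳ (q (x [ i ]≔ true)) ⟩
    0ℚ                                         ∎
    where open ≡-Reasoning

  HasDegree≤-resp-≗ : ∀ d {q r : Cube n → ℚ} → q ≗ r → HasDegree≤ d q → HasDegree≤ d r
  HasDegree≤-resp-≗ zero    q≗r h x y = trans (sym (q≗r x)) (trans (h x y) (q≗r y))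
  HasDegree≤-resp-≗ (suc d) q≗r h i = HasDegree≤-resp-≗ d (∂-cong i q≗r) (h i)

  HasDegree≤-const : ∀ d {q : Cube n → ℚ} → HasDegree≤ zero q → HasDegree≤ d q
  HasDegree≤-const zero    h = h
  HasDegree≤-const (suc d) h i = HasDegree≤-const d λ x y → trans (∂-const i h x) (sym (∂-const i h y))

  HasDegree≤-mono : ∀ {d e} {q : Cube n → ℚ} → d ≤ e → HasDegree≤ d q → HasDegree≤ e q
  HasDegree≤-mono {zero}  z≤n       h   = HasDegree≤-const _ h
  HasDegree≤-mono {suc d} (s≤s d≤e) h i = HasDegree≤-mono d≤e (h i)

  ∂-+ : ∀ (i : Fin n) (q r : Cube n → ℚ) → ∂ i (λ x → q x ℚ.+ r x) ≗ λ x → ∂ i q x ℚ.+ ∂ i r x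
  ∂-+ i q r x = lemma (q (x [ i ]≔ true)) (r (x [ i ]≔ true)) (q (x [ i ]≔ false)) (r (x [ i ]≔ false))
    where
    open +-*-Solver
    lemma : ∀ a b c d → (a ℚ.+ b) ℚ.- (c ℚ.+ d) ≡ (a ℚ.- c) ℚ.+ (b ℚ.- d)
    lemma = solve 4 (λ a b c d → (a :+ b) :- (c :+ d) := (a :- c) :+ (b :- d)) refl

  ∂-scale : ∀ (i : Fin n) k (q : Cube n → ℚ) → ∂ i (λ x → k ℚ.* q x) ≗ λ x → k ℚ.* ∂ i q x
  ∂-scale i k q x = lemma k (q (x [ i ]≔ true)) (q (x [ i ]≔ false))
    where
    open +-*-Solver
    lemma : ∀ k a c → k ℚ.* a ℚ.- k ℚ.* c ≡ k ℚ.* (a ℚ.- c)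
    lemma = solve 3 (λ k a c → k :* a :- k :* c := k :* (a :- c)) refl

  HasDegree≤-+ : ∀ d {q r : Cube n → ℚ} → HasDegree≤ d q → HasDegree≤ d r →
                 HasDegree≤ d (λ x → q x ℚ.+ r x)
  HasDegree≤-+ zero    hq hr x y = cong₂ ℚ._+_ (hq x y) (hr x y)
  HasDegree≤-+ (suc d) {q} {r} hq hr i = HasDegree≤-resp-≗ d (sym ∘ ∂-+ i q r) (HasDegree≤-+ d (hq i) (hr i))

  HasDegree≤-scale : ∀ d k {q : Cube n → ℚ} → HasDegree≤ d q → HasDegree≤ d (λ x → k ℚ.* q x)
  HasDegree≤-scale zero    k h x y = cong (k ℚ.*_) (h x y)
  HasDegree≤-scale (suc d) k {q} h i = HasDegree≤-resp-≗ d (sym ∘ ∂-scale i k q) (HasDegree≤-scale d k (h i))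

  HasDegree≤-restrict : ∀ d j b {q : Cube n → ℚ} → HasDegree≤ d q → HasDegree≤ d (λ x → q (x [ j ]≔ b))
  HasDegree≤-restrict zero    j b h x y = h _ _
  HasDegree≤-restrict (suc d) j b {q} h i with i Fin.≟ j
  ... | yes refl = HasDegree≤-const d λ x y → trans (vanish x) (sym (vanish y))
    where
    vanish : ∀ x → ∂ i (λ x → q (x [ i ]≔ b)) x ≡ 0ℚ
    vanish x = trans (cong₂ (λ u v → q u ℚ.- q v) ([]≔-idempotent x i) ([]≔-idempotent x i))
                     (ℚ.+-inverseʳ (q (x [ i ]≔ b)))
  ... | no i≢j = HasDegree≤-resp-≗ d
          (λ x → cong₂ (λ u v → q u ℚ.- q v) ([]≔-commutes x j i (i≢j ∘ sym))
                                              ([]≔-commutes x j i (i≢j ∘ sym)))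
          (HasDegree≤-restrict d j b (h i))

  HasDegree≤-coord : ∀ d j {q : Cube n → ℚ} → HasDegree≤ d q →
                     HasDegree≤ (suc d) (λ x → pm (lookup x j) ℚ.* q x)
  HasDegree≤-coord d j {q} h i with i Fin.≟ j
  ... | yes refl = HasDegree≤-resp-≗ d (sym ∘ ∂-coord-self)
                     (HasDegree≤-+ d (HasDegree≤-restrict d i true h) (HasDegree≤-restrict d i false h))
    where
    open +-*-Solver
    lemma : ∀ a c → 1ℚ ℚ.* a ℚ.- (ℚ.- 1ℚ) ℚ.* c ≡ a ℚ.+ c
    lemma = solve 2 (λ a c → con 1ℚ :* a :- (:- con 1ℚ) :* c := a :+ c) refl
    ∂-coord-self : ∀ x → ∂ i (λ x → pm (lookup x i) ℚ.* q x) x ≡ q (x [ i ]≔ true) ℚ.+ q (x [ i ]≔ false)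
    ∂-coord-self x = trans
      (cong₂ (λ u v → pm u ℚ.* q (x [ i ]≔ true) ℚ.- pm v ℚ.* q (x [ i ]≔ false))
             (lookup∘update i x true) (lookup∘update i x false))
      (lemma (q (x [ i ]≔ true)) (q (x [ i ]≔ false)))
  ... | no i≢j = HasDegree≤-resp-≗ d (sym ∘ ∂-coord-other) (coord-∂ d h)
    where
    ∂-coord-other : ∀ x → ∂ i (λ x → pm (lookup x j) ℚ.* q x) x ≡ pm (lookup x j) ℚ.* ∂ i q x
    ∂-coord-other x = trans
      (cong₂ (λ u v → pm u ℚ.* q (x [ i ]≔ true) ℚ.- pm v ℚ.* q (x [ i ]≔ false))
             (lookup∘update′ (i≢j ∘ sym) x true) (lookup∘update′ (i≢j ∘ sym) x false))
      (∂-scale i (pm (lookup x j)) q x)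
    coord-∂ : ∀ d → HasDegree≤ d q → HasDegree≤ d (λ x → pm (lookup x j) ℚ.* ∂ i q x)
    coord-∂ zero    h = HasDegree≤-resp-≗ zero
                          (λ x → trans (sym (ℚ.*-zeroʳ (pm (lookup x j))))
                                       (cong (pm (lookup x j) ℚ.*_) (sym (∂-const i h x))))
                          (λ _ _ → refl)
    coord-∂ (suc d) h = HasDegree≤-coord d j (h i)

evalMono-degree : ∀ {n} (m : Monomial n) → HasDegree≤ (length m) (evalMono m)
evalMono-degree []      = λ _ _ → refl
evalMono-degree (j ∷ m) = HasDegree≤-coord (length m) j (evalMono-degree m)

evalPoly-degree : ∀ {n} d (P : Poly n) → DegreeAtMost d P → HasDegree≤ d (evalPoly P)
evalPoly-degree d []             []         = HasDegree≤-const d λ _ _ → refl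
evalPoly-degree d ((c , m) ∷ P) (m≤d ∷ P≤d) =
  HasDegree≤-+ d (HasDegree≤-scale d c (HasDegree≤-mono m≤d (evalMono-degree m))) (evalPoly-degree d P P≤d)

∑ : ∀ {A : Set} → List A → (A → ℤ) → ℤ
∑ []       f = 0ℤ
∑ (a ∷ as) f = f a ℤ.+ ∑ as f

syntax ∑ L (λ x → e) = ∑[ x ∈ L ] e

module _ {A : Set} where

  ∑-cong : ∀ (L : List A) {f g} → f ≗ g → ∑ L f ≡ ∑ L g
  ∑-cong []       f≗g = refl
  ∑-cong (a ∷ as) f≗g = cong₂ ℤ._+_ (f≗g a) (∑-cong as f≗g)

  ∑-mono-≤ : ∀ (L : List A) {f g} → (∀ a → f a ℤ.≤ g a) → ∑ L f ℤ.≤ ∑ L g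
  ∑-mono-≤ []       f≤g = ℤ.≤-refl
  ∑-mono-≤ (a ∷ as) f≤g = ℤ.+-mono-≤ (f≤g a) (∑-mono-≤ as f≤g)

  ∑-nonNeg : ∀ (L : List A) {f} → (∀ a → 0ℤ ℤ.≤ f a) → 0ℤ ℤ.≤ ∑ L f
  ∑-nonNeg []       f≥0 = ℤ.≤-refl
  ∑-nonNeg (a ∷ as) f≥0 = ℤ.+-mono-≤ (f≥0 a) (∑-nonNeg as f≥0)

  ∑-zero : ∀ (L : List A) → ∑[ _ ∈ L ] 0ℤ ≡ 0ℤ
  ∑-zero []       = refl
  ∑-zero (a ∷ as) = trans (ℤ.+-identityˡ (∑[ _ ∈ as ] 0ℤ)) (∑-zero as)

  ∑-const : ∀ (L : List A) c → ∑[ _ ∈ L ] c ≡ + length L ℤ.* c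
  ∑-const []       c = refl
  ∑-const (a ∷ as) c = begin
    c ℤ.+ ∑[ _ ∈ as ] c           ≡⟨ cong (ℤ._+_ c) (∑-const as c) ⟩
    c ℤ.+ + length as ℤ.* c       ≡⟨ lemma c (+ length as) ⟩
    (1ℤ ℤ.+ + length as) ℤ.* c    ∎
    where
    open ≡-Reasoning
    lemma : ∀ c l → c ℤ.+ l ℤ.* c ≡ (1ℤ ℤ.+ l) ℤ.* c
    lemma = solve-∀

  ∑-+ : ∀ (L : List A) f g → ∑[ a ∈ L ] (f a ℤ.+ g a) ≡ ∑ L f ℤ.+ ∑ L g
  ∑-+ []       f g = refl
  ∑-+ (a ∷ as) f g = trans (cong (ℤ._+_ (f a ℤ.+ g a)) (∑-+ as f g)) (lemma (f a) (g a) (∑ as f) (∑ as g))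
    where
    lemma : ∀ a b c d → a ℤ.+ b ℤ.+ (c ℤ.+ d) ≡ a ℤ.+ c ℤ.+ (b ℤ.+ d)
    lemma = solve-∀

  ∑-*ˡ : ∀ (L : List A) c f → ∑[ a ∈ L ] (c ℤ.* f a) ≡ c ℤ.* ∑ L f
  ∑-*ˡ []       c f = sym (ℤ.*-zeroʳ c)
  ∑-*ˡ (a ∷ as) c f = trans (cong (ℤ._+_ (c ℤ.* f a)) (∑-*ˡ as c f)) (sym (ℤ.*-distribˡ-+ c (f a) (∑ as f)))

  ∑-*ʳ : ∀ (L : List A) c f → ∑[ a ∈ L ] (f a ℤ.* c) ≡ ∑ L f ℤ.* c
  ∑-*ʳ L c f = begin
    ∑[ a ∈ L ] (f a ℤ.* c)  ≡⟨ ∑-cong L (λ a → ℤ.*-comm (f a) c) ⟩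
    ∑[ a ∈ L ] (c ℤ.* f a)  ≡⟨ ∑-*ˡ L c f ⟩
    c ℤ.* ∑ L f             ≡⟨ ℤ.*-comm c (∑ L f) ⟩
    ∑ L f ℤ.* c             ∎
    where open ≡-Reasoning

  ∑-++ : ∀ (L M : List A) f → ∑ (L ++ M) f ≡ ∑ L f ℤ.+ ∑ M f
  ∑-++ []       M f = sym (ℤ.+-identityˡ (∑ M f))
  ∑-++ (a ∷ as) M f = trans (cong (ℤ._+_ (f a)) (∑-++ as M f)) (sym (ℤ.+-assoc (f a) (∑ as f) (∑ M f)))

  ∑-pos : ∀ (L : List A) (g : A → ℕ) → + sum (map g L) ≡ ∑[ a ∈ L ] (+ g a)
  ∑-pos []       g = refl
  ∑-pos (a ∷ as) g = trans (ℤ.pos-+ (g a) (sum (map g as))) (cong (ℤ._+_ (+ g a)) (∑-pos as g))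

∑-map : ∀ {A B : Set} (L : List A) (g : A → B) (f : B → ℤ) → ∑ (map g L) f ≡ ∑[ a ∈ L ] f (g a)
∑-map []       g f = refl
∑-map (a ∷ as) g f = cong (ℤ._+_ (f (g a))) (∑-map as g f)

∑-comm : ∀ {A B : Set} (L : List A) (M : List B) (f : A → B → ℤ) →
         ∑[ a ∈ L ] ∑[ b ∈ M ] f a b ≡ ∑[ b ∈ M ] ∑[ a ∈ L ] f a b
∑-comm []       M f = sym (∑-zero M)
∑-comm (a ∷ as) M f = trans (cong (ℤ._+_ (∑ M (f a))) (∑-comm as M f)) (sym (∑-+ M (f a) _))

∑-*-∑ : ∀ {A B : Set} (L : List A) (M : List B) (f : A → ℤ) (g : B → ℤ) →
        ∑ L f ℤ.* ∑ M g ≡ ∑[ a ∈ L ] ∑[ b ∈ M ] (f a ℤ.* g b)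
∑-*-∑ L M f g = trans (sym (∑-*ʳ L (∑ M g) f)) (∑-cong L λ a → sym (∑-*ˡ M (f a) g))

square-nonNeg : ∀ i → 0ℤ ℤ.≤ i ℤ.* i
square-nonNeg (+ n)      = subst (0ℤ ℤ.≤_) (sym (ℤ.+◃n≡+n (n * n))) (ℤ.+≤+ z≤n)
square-nonNeg ℤ.-[1+ n ] = subst (0ℤ ℤ.≤_) (sym (ℤ.+◃n≡+n (suc n * suc n))) (ℤ.+≤+ z≤n)

module _ {A : Set} where

  ∑-square-shift : ∀ (L : List A) a c →
    ∑[ x ∈ L ] ((a x ℤ.- c) ℤ.* (a x ℤ.- c))
      ≡ ∑[ x ∈ L ] (a x ℤ.* a x) ℤ.- + 2 ℤ.* c ℤ.* ∑ L a ℤ.+ + length L ℤ.* (c ℤ.* c)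
  ∑-square-shift []       a c = lemma c
    where
    lemma : ∀ c → 0ℤ ≡ 0ℤ ℤ.- + 2 ℤ.* c ℤ.* 0ℤ ℤ.+ 0ℤ ℤ.* (c ℤ.* c)
    lemma = solve-∀
  ∑-square-shift (x ∷ xs) a c =
    trans (cong (ℤ._+_ ((a x ℤ.- c) ℤ.* (a x ℤ.- c))) (∑-square-shift xs a c))
          (lemma (a x) c (∑[ x ∈ xs ] (a x ℤ.* a x)) (∑ xs a) (+ length xs))
    where
    lemma : ∀ y c Q s l → (y ℤ.- c) ℤ.* (y ℤ.- c) ℤ.+ (Q ℤ.- + 2 ℤ.* c ℤ.* s ℤ.+ l ℤ.* (c ℤ.* c))
            ≡ (y ℤ.* y ℤ.+ Q) ℤ.- + 2 ℤ.* c ℤ.* (y ℤ.+ s) ℤ.+ (1ℤ ℤ.+ l) ℤ.* (c ℤ.* c)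
    lemma = solve-∀

  cauchy-schwarz : ∀ (L : List A) a → ∑ L a ℤ.* ∑ L a ℤ.≤ + length L ℤ.* ∑[ x ∈ L ] (a x ℤ.* a x)
  cauchy-schwarz L a = ℤ.0≤i-j⇒j≤i (gap-nonNeg L)
    where
    -- Adding the point x to xs increases the gap by ∑_{y ∈ xs} (a y − a x)².
    gap-nonNeg : ∀ L → 0ℤ ℤ.≤ + length L ℤ.* ∑[ x ∈ L ] (a x ℤ.* a x) ℤ.- ∑ L a ℤ.* ∑ L a
    gap-nonNeg []       = ℤ.≤-refl
    gap-nonNeg (x ∷ xs) = subst (0ℤ ℤ.≤_) (sym (lemma (a x) (∑[ x ∈ xs ] (a x ℤ.* a x)) (∑ xs a) (+ length xs)))
      (ℤ.+-mono-≤ (gap-nonNeg xs)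
        (subst (0ℤ ℤ.≤_) (∑-square-shift xs a (a x)) (∑-nonNeg xs λ y → square-nonNeg (a y ℤ.- a x))))
      where
      lemma : ∀ y Q s l → (1ℤ ℤ.+ l) ℤ.* (y ℤ.* y ℤ.+ Q) ℤ.- (y ℤ.+ s) ℤ.* (y ℤ.+ s)
              ≡ (l ℤ.* Q ℤ.- s ℤ.* s) ℤ.+ (Q ℤ.- + 2 ℤ.* y ℤ.* s ℤ.+ l ℤ.* (y ℤ.* y))
      lemma = solve-∀

∑-allCube-suc : ∀ {n} (h : Cube (suc n) → ℤ) →
  ∑ (allCube (suc n)) h ≡ ∑[ x ∈ allCube n ] h (true ∷ x) ℤ.+ ∑[ x ∈ allCube n ] h (false ∷ x)
∑-allCube-suc {n} h = trans (∑-++ (map (true ∷_) (allCube n)) (map (false ∷_) (allCube n)) h)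
  (cong₂ ℤ._+_ (∑-map (allCube n) (true ∷_) h) (∑-map (allCube n) (false ∷_) h))

∑-flipAt : ∀ {n} (i : Fin n) (h : Cube n → ℤ) → ∑[ x ∈ allCube n ] h (flipAt x i) ≡ ∑ (allCube n) h
∑-flipAt {suc n} Fin.zero    h = begin
  ∑[ x ∈ allCube (suc n) ] h (flipAt x Fin.zero)
    ≡⟨ ∑-allCube-suc (λ x → h (flipAt x Fin.zero)) ⟩
  ∑[ x ∈ allCube n ] h (false ∷ x) ℤ.+ ∑[ x ∈ allCube n ] h (true ∷ x)
    ≡⟨ ℤ.+-comm (∑[ x ∈ allCube n ] h (false ∷ x)) _ ⟩
  ∑[ x ∈ allCube n ] h (true ∷ x) ℤ.+ ∑[ x ∈ allCube n ] h (false ∷ x)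
    ≡⟨ ∑-allCube-suc h ⟨
  ∑ (allCube (suc n)) h ∎
  where open ≡-Reasoning
∑-flipAt {suc n} (Fin.suc i) h = begin
  ∑[ x ∈ allCube (suc n) ] h (flipAt x (Fin.suc i))        ≡⟨ ∑-allCube-suc (λ x → h (flipAt x (Fin.suc i))) ⟩
  ∑[ x ∈ allCube n ] h (true ∷ flipAt x i) ℤ.+ ∑[ x ∈ allCube n ] h (false ∷ flipAt x i)
    ≡⟨ cong₂ ℤ._+_ (∑-flipAt i (h ∘ (true ∷_))) (∑-flipAt i (h ∘ (false ∷_))) ⟩
  ∑[ x ∈ allCube n ] h (true ∷ x) ℤ.+ ∑[ x ∈ allCube n ] h (false ∷ x) ≡⟨ ∑-allCube-suc h ⟨
  ∑ (allCube (suc n)) h                                    ∎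
  where open ≡-Reasoning

length-allCube : ∀ n → length (allCube n) ≡ 2 ^ n
length-allCube zero    = refl
length-allCube (suc n) = begin
  length (map (true ∷_) (allCube n) ++ map (false ∷_) (allCube n))
    ≡⟨ length-++ (map (true ∷_) (allCube n)) ⟩
  length (map (true ∷_) (allCube n)) + length (map (false ∷_) (allCube n))
    ≡⟨ cong₂ _+_ (length-map _ (allCube n)) (length-map _ (allCube n)) ⟩
  length (allCube n) + length (allCube n)
    ≡⟨ cong (λ l → l + l) (length-allCube n) ⟩
  2 ^ n + 2 ^ n
    ≡⟨ cong (λ t → 2 ^ n + t) (sym (ℕ.+-identityʳ (2 ^ n))) ⟩
  2 ^ suc n ∎
  where open ≡-Reasoning

∑-allFin-suc : ∀ n (h : Fin (suc n) → ℤ) → ∑ (allFin (suc n)) h ≡ h Fin.zero ℤ.+ ∑[ j ∈ allFin n ] h (Fin.suc j)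
∑-allFin-suc n h = cong (ℤ._+_ (h Fin.zero))
  (trans (cong (λ L → ∑ L h) (sym (map-tabulate id Fin.suc))) (∑-map (allFin n) Fin.suc h))

length-allFin : ∀ n → length (allFin n) ≡ n
length-allFin n = length-tabulate id

δ : ∀ {n} → Fin n → Fin n → ℤ
δ Fin.zero    Fin.zero    = 1ℤ
δ Fin.zero    (Fin.suc _) = 0ℤ
δ (Fin.suc _) Fin.zero    = 0ℤ
δ (Fin.suc i) (Fin.suc j) = δ i j

δ-diag : ∀ {n} (i : Fin n) → δ i i ≡ 1ℤ
δ-diag Fin.zero    = refl
δ-diag (Fin.suc i) = δ-diag i

δ-offDiag : ∀ {n} {i j : Fin n} → i ≢ j → δ i j ≡ 0ℤ
δ-offDiag {i = Fin.zero}  {Fin.zero}  i≢j = contradiction refl i≢j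
δ-offDiag {i = Fin.zero}  {Fin.suc _} i≢j = refl
δ-offDiag {i = Fin.suc _} {Fin.zero}  i≢j = refl
δ-offDiag {i = Fin.suc i} {Fin.suc j} i≢j = δ-offDiag (i≢j ∘ cong Fin.suc)

∑-δ : ∀ {n} (i : Fin n) → ∑[ j ∈ allFin n ] δ i j ≡ 1ℤ
∑-δ {suc n} Fin.zero    = trans (∑-allFin-suc n (δ Fin.zero)) (cong (ℤ._+_ 1ℤ) (∑-zero (allFin n)))
∑-δ {suc n} (Fin.suc i) = trans (∑-allFin-suc n (δ (Fin.suc i))) (trans (ℤ.+-identityˡ _) (∑-δ i))

p<q⇒0<q-p : ∀ p q → p ℚ.< q → 0ℚ ℚ.< q ℚ.- p
p<q⇒0<q-p p q p<q = subst (ℚ._< q ℚ.- p) (ℚ.+-inverseʳ p) (ℚ.+-monoˡ-< (ℚ.- p) p<q)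

p<q⇒p-q<0 : ∀ p q → p ℚ.< q → p ℚ.- q ℚ.< 0ℚ
p<q⇒p-q<0 p q p<q = subst (p ℚ.- q ℚ.<_) (ℚ.+-inverseʳ q) (ℚ.+-monoˡ-< (ℚ.- q) p<q)

sgn≡true⇒ : ∀ b q → sgn b q ≡ true → 0ℚ ℚ.< q ⊎ (q ≡ 0ℚ × b ≡ true)
sgn≡true⇒ b q sgn≡true with 0ℚ ℚ.<? q
... | yes 0<q = inj₁ 0<q
... | no _ with q ℚ.≟ 0ℚ
...   | yes q≡0 = inj₂ (q≡0 , sgn≡true)
sgn≡true⇒ b q () | no _ | no _

sgn≡false⇒ : ∀ b q → sgn b q ≡ false → q ℚ.< 0ℚ ⊎ (q ≡ 0ℚ × b ≡ false)
sgn≡false⇒ b q sgn≡false with 0ℚ ℚ.<? q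
sgn≡false⇒ b q () | yes _
... | no 0≮q with q ℚ.≟ 0ℚ
...   | yes q≡0 = inj₂ (q≡0 , sgn≡false)
...   | no q≢0 with ℚ.<-cmp q 0ℚ
...     | tri< q<0 _ _ = inj₁ q<0
...     | tri≈ _ q≡0 _ = contradiction q≡0 q≢0
...     | tri> _ _ 0<q = contradiction 0<q 0≮q

sgn-pos : ∀ b q → 0ℚ ℚ.< q → sgn b q ≡ true
sgn-pos b q 0<q with 0ℚ ℚ.<? q
... | yes _  = refl
... | no 0≮q = contradiction 0<q 0≮q

sgn-neg : ∀ b q → q ℚ.< 0ℚ → sgn b q ≡ false
sgn-neg b q q<0 with 0ℚ ℚ.<? q
... | yes 0<q = contradiction 0<q (ℚ.<-asym q<0)
... | no _ with q ℚ.≟ 0ℚ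
...   | yes q≡0 = contradiction q≡0 (ℚ.<⇒≢ q<0)
...   | no _    = refl

sgn-true-false⇒< : ∀ b u v → sgn b u ≡ true → sgn b v ≡ false → v ℚ.< u
sgn-true-false⇒< b u v su sv with sgn≡true⇒ b u su | sgn≡false⇒ b v sv
... | inj₁ 0<u            | inj₁ v<0            = ℚ.<-trans v<0 0<u
... | inj₁ 0<u            | inj₂ (refl , _)     = 0<u
... | inj₂ (refl , _)     | inj₁ v<0            = v<0
... | inj₂ (_ , refl)     | inj₂ (_ , ())

-- The convention c at 0 plays no role, since u − v ≠ 0 across a change of sign.
sgn-across-change : ∀ b c u v → sgn b u xor sgn b v ≡ true → sgn c (u ℚ.- v) ≡ sgn b u
sgn-across-change b c u v change with sgn b u in su | sgn b v in sv
... | true  | false = sgn-pos c (u ℚ.- v) (p<q⇒0<q-p v u (sgn-true-false⇒< b u v su sv))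
... | false | true  = sgn-neg c (u ℚ.- v) (p<q⇒p-q<0 u v (sgn-true-false⇒< b v u sv su))
sgn-across-change b c u v () | true  | true
sgn-across-change b c u v () | false | false

pmℤ : Bool → ℤ
pmℤ true  = 1ℤ
pmℤ false = -1ℤ

𝟙 : Bool → ℤ
𝟙 b = if b then 1ℤ else 0ℤ

pmℤ-not : ∀ a → pmℤ (not a) ≡ ℤ.- pmℤ a
pmℤ-not true  = refl
pmℤ-not false = refl

pmℤ-square : ∀ a → pmℤ a ℤ.* pmℤ a ≡ 1ℤ
pmℤ-square true  = refl
pmℤ-square false = refl

pmℤ-* : ∀ a b → pmℤ a ℤ.* pmℤ b ≡ pmℤ (not (a xor b))
pmℤ-* true  true  = refl
pmℤ-* true  false = refl
pmℤ-* false true  = refl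
pmℤ-* false false = refl

pmℤ-jump-≤ : ∀ s u v → pmℤ s ℤ.* (pmℤ u ℤ.- pmℤ v) ℤ.≤ + 2 ℤ.* 𝟙 (u xor v)
pmℤ-jump-≤ s     true  true  = ℤ.≤-reflexive (ℤ.*-zeroʳ (pmℤ s))
pmℤ-jump-≤ s     false false = ℤ.≤-reflexive (ℤ.*-zeroʳ (pmℤ s))
pmℤ-jump-≤ true  true  false = ℤ.≤-refl
pmℤ-jump-≤ false true  false = ℤ.-≤+
pmℤ-jump-≤ true  false true  = ℤ.-≤+
pmℤ-jump-≤ false false true  = ℤ.≤-refl

pmℤ-jump-≡ : ∀ s u v → (u xor v ≡ true → s ≡ u) → pmℤ s ℤ.* (pmℤ u ℤ.- pmℤ v) ≡ + 2 ℤ.* 𝟙 (u xor v)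
pmℤ-jump-≡ s     true  true  _     = ℤ.*-zeroʳ (pmℤ s)
pmℤ-jump-≡ s     false false _     = ℤ.*-zeroʳ (pmℤ s)
pmℤ-jump-≡ s     true  false s≡u   rewrite s≡u refl = refl
pmℤ-jump-≡ s     false true  s≡u   rewrite s≡u refl = refl

-- The edge at x in direction i, with F a = f (x [ i ]≔ a), a = x_i and G = g_i(x).
line-identity : ∀ (F : Bool → Bool) G → (F true xor F false ≡ true → G ≡ F true) → ∀ a →
  pmℤ (F a) ℤ.* pmℤ a ℤ.* pmℤ G ℤ.+ pmℤ (F (not a)) ℤ.* pmℤ (not a) ℤ.* pmℤ G
    ≡ + 2 ℤ.* 𝟙 (F a xor F (not a))
line-identity F G agree true  =
  trans (lemma (pmℤ (F true)) (pmℤ (F false)) (pmℤ G)) (pmℤ-jump-≡ G (F true) (F false) agree)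
  where
  lemma : ∀ u v g → u ℤ.* 1ℤ ℤ.* g ℤ.+ v ℤ.* -1ℤ ℤ.* g ≡ g ℤ.* (u ℤ.- v)
  lemma = solve-∀
line-identity F G agree false = begin
  pmℤ (F false) ℤ.* -1ℤ ℤ.* pmℤ G ℤ.+ pmℤ (F true) ℤ.* 1ℤ ℤ.* pmℤ G
    ≡⟨ lemma (pmℤ (F true)) (pmℤ (F false)) (pmℤ G) ⟩
  pmℤ G ℤ.* (pmℤ (F true) ℤ.- pmℤ (F false))
    ≡⟨ pmℤ-jump-≡ G (F true) (F false) agree ⟩
  + 2 ℤ.* 𝟙 (F true xor F false)
    ≡⟨ cong (λ t → + 2 ℤ.* 𝟙 t) (xor-comm (F true) (F false)) ⟩
  + 2 ℤ.* 𝟙 (F false xor F true) ∎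
  where
  open ≡-Reasoning
  lemma : ∀ u v g → v ℤ.* -1ℤ ℤ.* g ℤ.+ u ℤ.* 1ℤ ℤ.* g ≡ g ℤ.* (u ℤ.- v)
  lemma = solve-∀

pair-offDiag : ∀ a c G u v →
  pmℤ a ℤ.* pmℤ u ℤ.* (pmℤ c ℤ.* pmℤ G) ℤ.+ pmℤ a ℤ.* pmℤ v ℤ.* (pmℤ (not c) ℤ.* pmℤ G)
    ℤ.≤ + 2 ℤ.* 𝟙 (u xor v)
pair-offDiag a c G u v = begin
  pmℤ a ℤ.* pmℤ u ℤ.* (pmℤ c ℤ.* pmℤ G) ℤ.+ pmℤ a ℤ.* pmℤ v ℤ.* (pmℤ (not c) ℤ.* pmℤ G)
    ≡⟨ cong (λ t → pmℤ a ℤ.* pmℤ u ℤ.* (pmℤ c ℤ.* pmℤ G) ℤ.+ pmℤ a ℤ.* pmℤ v ℤ.* (t ℤ.* pmℤ G))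
            (pmℤ-not c) ⟩
  pmℤ a ℤ.* pmℤ u ℤ.* (pmℤ c ℤ.* pmℤ G) ℤ.+ pmℤ a ℤ.* pmℤ v ℤ.* (ℤ.- pmℤ c ℤ.* pmℤ G)
    ≡⟨ lemma (pmℤ a) (pmℤ c) (pmℤ G) (pmℤ u) (pmℤ v) ⟩
  pmℤ a ℤ.* pmℤ c ℤ.* pmℤ G ℤ.* (pmℤ u ℤ.- pmℤ v)
    ≡⟨ cong (λ t → t ℤ.* pmℤ G ℤ.* (pmℤ u ℤ.- pmℤ v)) (pmℤ-* a c) ⟩
  pmℤ (not (a xor c)) ℤ.* pmℤ G ℤ.* (pmℤ u ℤ.- pmℤ v)
    ≡⟨ cong (ℤ._* (pmℤ u ℤ.- pmℤ v)) (pmℤ-* (not (a xor c)) G) ⟩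
  pmℤ (not (not (a xor c) xor G)) ℤ.* (pmℤ u ℤ.- pmℤ v)
    ≤⟨ pmℤ-jump-≤ (not (not (a xor c) xor G)) u v ⟩
  + 2 ℤ.* 𝟙 (u xor v) ∎
  where
  open ℤ.≤-Reasoning
  lemma : ∀ a c g u v → a ℤ.* u ℤ.* (c ℤ.* g) ℤ.+ a ℤ.* v ℤ.* (ℤ.- c ℤ.* g) ≡ a ℤ.* c ℤ.* g ℤ.* (u ℤ.- v)
  lemma = solve-∀

∂-flipAt : ∀ {n} (i : Fin n) (q : Cube n → ℚ) x → ∂ i q (flipAt x i) ≡ ∂ i q x
∂-flipAt i q x = cong₂ (λ u v → q u ℚ.- q v) (updateAt-updateAt i x) (updateAt-updateAt i x)

module _ {n : ℕ} where

  ∑-flipAt-pairs : ∀ (i : Fin n) h → + 2 ℤ.* ∑ (allCube n) h ≡ ∑[ x ∈ allCube n ] (h x ℤ.+ h (flipAt x i))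
  ∑-flipAt-pairs i h = begin
    + 2 ℤ.* ∑ (allCube n) h                                     ≡⟨ double (∑ (allCube n) h) ⟩
    ∑ (allCube n) h ℤ.+ ∑ (allCube n) h                         ≡⟨ cong (ℤ._+_ (∑ (allCube n) h)) (∑-flipAt i h) ⟨
    ∑ (allCube n) h ℤ.+ ∑[ x ∈ allCube n ] h (flipAt x i)       ≡⟨ ∑-+ (allCube n) h (λ x → h (flipAt x i)) ⟨
    ∑[ x ∈ allCube n ] (h x ℤ.+ h (flipAt x i))                 ∎
    where
    open ≡-Reasoning
    double : ∀ t → + 2 ℤ.* t ≡ t ℤ.+ t
    double = solve-∀

  ∑-by-pairs-≡ : ∀ (i : Fin n) {h k} → (∀ x → h x ℤ.+ h (flipAt x i) ≡ + 2 ℤ.* k x) →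
                 ∑ (allCube n) h ≡ ∑ (allCube n) k
  ∑-by-pairs-≡ i {h} {k} pairs = ℤ.*-cancelˡ-≡ (+ 2) _ _ (begin
    + 2 ℤ.* ∑ (allCube n) h                       ≡⟨ ∑-flipAt-pairs i h ⟩
    ∑[ x ∈ allCube n ] (h x ℤ.+ h (flipAt x i))   ≡⟨ ∑-cong (allCube n) pairs ⟩
    ∑[ x ∈ allCube n ] (+ 2 ℤ.* k x)              ≡⟨ ∑-*ˡ (allCube n) (+ 2) k ⟩
    + 2 ℤ.* ∑ (allCube n) k                       ∎)
    where open ≡-Reasoning

  ∑-by-pairs-≤ : ∀ (i : Fin n) {h k} → (∀ x → h x ℤ.+ h (flipAt x i) ℤ.≤ + 2 ℤ.* k x) →
                 ∑ (allCube n) h ℤ.≤ ∑ (allCube n) k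
  ∑-by-pairs-≤ i {h} {k} pairs = ℤ.*-cancelˡ-≤-pos _ _ (+ 2) (begin
    + 2 ℤ.* ∑ (allCube n) h                       ≡⟨ ∑-flipAt-pairs i h ⟩
    ∑[ x ∈ allCube n ] (h x ℤ.+ h (flipAt x i))   ≤⟨ ∑-mono-≤ (allCube n) pairs ⟩
    ∑[ x ∈ allCube n ] (+ 2 ℤ.* k x)              ≡⟨ ∑-*ˡ (allCube n) (+ 2) k ⟩
    + 2 ℤ.* ∑ (allCube n) k                       ∎)
    where open ℤ.≤-Reasoning

  sensAt : (Cube n → Bool) → Fin n → ℤ
  sensAt φ i = ∑[ x ∈ allCube n ] 𝟙 (φ x xor φ (flipAt x i))

  sensℤ : (Cube n → Bool) → ℤ
  sensℤ φ = ∑[ i ∈ allFin n ] sensAt φ i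

  sensCount≡sensℤ : ∀ φ → + sensCount φ ≡ sensℤ φ
  sensCount≡sensℤ φ = begin
    + sensCount φ
      ≡⟨ ∑-pos (allCube n) _ ⟩
    ∑[ x ∈ allCube n ] (+ sum (map (indicator x) (allFin n)))
      ≡⟨ ∑-cong (allCube n) (λ x → ∑-pos (allFin n) (indicator x)) ⟩
    ∑[ x ∈ allCube n ] ∑[ i ∈ allFin n ] (+ indicator x i)
      ≡⟨ ∑-cong (allCube n) (λ x → ∑-cong (allFin n) (λ i → pos-if (φ x xor φ (flipAt x i)))) ⟩
    ∑[ x ∈ allCube n ] ∑[ i ∈ allFin n ] 𝟙 (φ x xor φ (flipAt x i))
      ≡⟨ ∑-comm (allCube n) (allFin n) _ ⟩
    sensℤ φ ∎
    where
    open ≡-Reasoning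
    indicator : Cube n → Fin n → ℕ
    indicator x i = if φ x xor φ (flipAt x i) then 1 else 0
    pos-if : ∀ c → + (if c then 1 else 0) ≡ 𝟙 c
    pos-if true  = refl
    pos-if false = refl

  sensAt-nonNeg : ∀ φ i → 0ℤ ℤ.≤ sensAt φ i
  sensAt-nonNeg φ i = ∑-nonNeg (allCube n) λ x → 𝟙-nonNeg (φ x xor φ (flipAt x i))
    where
    𝟙-nonNeg : ∀ c → 0ℤ ℤ.≤ 𝟙 c
    𝟙-nonNeg true  = ℤ.+≤+ z≤n
    𝟙-nonNeg false = ℤ.≤-refl

module SensitivityRecursion {n} (q : Cube n → ℚ) (b : Bool) where

  f : Cube n → Bool
  f x = sgn b (q x)

  g : Fin n → Cube n → Bool
  g i x = sgn true (∂ i q x)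

  χ : Fin n → Cube n → ℤ
  χ i x = pmℤ (lookup x i)

  A : Cube n → ℤ
  A x = ∑[ i ∈ allFin n ] (χ i x ℤ.* pmℤ (g i x))

  N : ℤ
  N = + length (allCube n)

  -- At a sensitive edge in direction i, f agrees with x_i · g_i; the edge contributes 2 to both sides.
  sensitive-edge : ∀ i x →
    pmℤ (f x) ℤ.* χ i x ℤ.* pmℤ (g i x) ℤ.+ pmℤ (f (flipAt x i)) ℤ.* χ i (flipAt x i) ℤ.* pmℤ (g i (flipAt x i))
      ≡ + 2 ℤ.* 𝟙 (f x xor f (flipAt x i))
  sensitive-edge i x = begin
    term (f x) a (g i x) ℤ.+ term (f (flipAt x i)) (lookup (flipAt x i) i) (g i (flipAt x i))
      ≡⟨ cong₂ (λ y z → term (f y) a (g i x) ℤ.+ term (f z) (lookup (flipAt x i) i) (g i (flipAt x i)))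
               (sym ([]≔-lookup x i)) flip≡update ⟩
    term (F a) a (g i x) ℤ.+ term (F (not a)) (lookup (flipAt x i) i) (g i (flipAt x i))
      ≡⟨ cong₂ (λ c G → term (F a) a (g i x) ℤ.+ term (F (not a)) c G)
               (lookup∘updateAt i x) (cong (sgn true) (∂-flipAt i q x)) ⟩
    term (F a) a (g i x) ℤ.+ term (F (not a)) (not a) (g i x)
      ≡⟨ line-identity F (g i x) (sgn-across-change b true (q (x [ i ]≔ true)) (q (x [ i ]≔ false))) a ⟩
    + 2 ℤ.* 𝟙 (F a xor F (not a))
      ≡⟨ cong₂ (λ y z → + 2 ℤ.* 𝟙 (f y xor f z)) ([]≔-lookup x i) (sym flip≡update) ⟩
    + 2 ℤ.* 𝟙 (f x xor f (flipAt x i)) ∎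
    where
    open ≡-Reasoning
    a = lookup x i
    F : Bool → Bool
    F c = f (x [ i ]≔ c)
    term : Bool → Bool → Bool → ℤ
    term u c G = pmℤ u ℤ.* pmℤ c ℤ.* pmℤ G
    flip≡update : flipAt x i ≡ x [ i ]≔ not a
    flip≡update = updateAt-cong-local i x refl

  sens≡correlation : sensℤ f ≡ ∑[ x ∈ allCube n ] (pmℤ (f x) ℤ.* A x)
  sens≡correlation = begin
    ∑[ i ∈ allFin n ] sensAt f i
      ≡⟨ ∑-cong (allFin n) (λ i → sym (∑-by-pairs-≡ i (sensitive-edge i))) ⟩
    ∑[ i ∈ allFin n ] ∑[ x ∈ allCube n ] h i x
      ≡⟨ ∑-comm (allFin n) (allCube n) h ⟩
    ∑[ x ∈ allCube n ] ∑[ i ∈ allFin n ] h i x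
      ≡⟨ ∑-cong (allCube n) (λ x → ∑-cong (allFin n) (λ i → ℤ.*-assoc (pmℤ (f x)) _ _)) ⟩
    ∑[ x ∈ allCube n ] ∑[ i ∈ allFin n ] (pmℤ (f x) ℤ.* (χ i x ℤ.* pmℤ (g i x)))
      ≡⟨ ∑-cong (allCube n) (λ x → ∑-*ˡ (allFin n) (pmℤ (f x)) _) ⟩
    ∑[ x ∈ allCube n ] (pmℤ (f x) ℤ.* A x) ∎
    where
    open ≡-Reasoning
    h : Fin n → Cube n → ℤ
    h i x = pmℤ (f x) ℤ.* χ i x ℤ.* pmℤ (g i x)

  sens²≤N*∑A² : sensℤ f ℤ.* sensℤ f ℤ.≤ N ℤ.* ∑[ x ∈ allCube n ] (A x ℤ.* A x)
  sens²≤N*∑A² = begin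
    sensℤ f ℤ.* sensℤ f
      ≡⟨ cong₂ ℤ._*_ sens≡correlation sens≡correlation ⟩
    ∑ (allCube n) fA ℤ.* ∑ (allCube n) fA
      ≤⟨ cauchy-schwarz (allCube n) fA ⟩
    N ℤ.* ∑[ x ∈ allCube n ] (fA x ℤ.* fA x)
      ≡⟨ cong (N ℤ.*_) (∑-cong (allCube n) λ x → sign-cancel (f x) (A x)) ⟩
    N ℤ.* ∑[ x ∈ allCube n ] (A x ℤ.* A x) ∎
    where
    open ℤ.≤-Reasoning
    fA : Cube n → ℤ
    fA x = pmℤ (f x) ℤ.* A x
    sign-cancel : ∀ s t → pmℤ s ℤ.* t ℤ.* (pmℤ s ℤ.* t) ≡ t ℤ.* t
    sign-cancel s t = begin-equality
      pmℤ s ℤ.* t ℤ.* (pmℤ s ℤ.* t)   ≡⟨ lemma (pmℤ s) t ⟩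
      pmℤ s ℤ.* pmℤ s ℤ.* (t ℤ.* t)   ≡⟨ cong (ℤ._* (t ℤ.* t)) (pmℤ-square s) ⟩
      1ℤ ℤ.* (t ℤ.* t)                ≡⟨ ℤ.*-identityˡ (t ℤ.* t) ⟩
      t ℤ.* t                         ∎
      where
      lemma : ∀ s t → s ℤ.* t ℤ.* (s ℤ.* t) ≡ s ℤ.* s ℤ.* (t ℤ.* t)
      lemma = solve-∀

  T : Fin n → Fin n → Cube n → ℤ
  T i j x = χ i x ℤ.* pmℤ (g i x) ℤ.* (χ j x ℤ.* pmℤ (g j x))

  ∑A²≡∑T : ∑[ x ∈ allCube n ] (A x ℤ.* A x) ≡ ∑[ i ∈ allFin n ] ∑[ j ∈ allFin n ] ∑[ x ∈ allCube n ] T i j x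
  ∑A²≡∑T = begin
    ∑[ x ∈ allCube n ] (A x ℤ.* A x)
      ≡⟨ ∑-cong (allCube n) (λ x → ∑-*-∑ (allFin n) (allFin n) _ _) ⟩
    ∑[ x ∈ allCube n ] ∑[ i ∈ allFin n ] ∑[ j ∈ allFin n ] T i j x
      ≡⟨ ∑-comm (allCube n) (allFin n) _ ⟩
    ∑[ i ∈ allFin n ] ∑[ x ∈ allCube n ] ∑[ j ∈ allFin n ] T i j x
      ≡⟨ ∑-cong (allFin n) (λ i → ∑-comm (allCube n) (allFin n) _) ⟩
    ∑[ i ∈ allFin n ] ∑[ j ∈ allFin n ] ∑[ x ∈ allCube n ] T i j x ∎
    where open ≡-Reasoning

  ∑T-diag : ∀ i → ∑[ x ∈ allCube n ] T i i x ≡ N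
  ∑T-diag i = begin
    ∑[ x ∈ allCube n ] T i i x     ≡⟨ ∑-cong (allCube n) T-one ⟩
    ∑[ _ ∈ allCube n ] 1ℤ          ≡⟨ ∑-const (allCube n) 1ℤ ⟩
    N ℤ.* 1ℤ                       ≡⟨ ℤ.*-identityʳ N ⟩
    N                              ∎
    where
    open ≡-Reasoning
    T-one : ∀ x → T i i x ≡ 1ℤ
    T-one x = trans (cong (λ t → t ℤ.* t) (pmℤ-* (lookup x i) (g i x))) (pmℤ-square (not (lookup x i xor g i x)))

  -- χ_i and g_j do not depend on x_j, so pairing x with its j-neighbour leaves only the change of g_i.
  ∑T-offDiag : ∀ {i j} → i ≢ j → ∑[ x ∈ allCube n ] T i j x ℤ.≤ sensAt (g i) j
  ∑T-offDiag {i} {j} i≢j = ∑-by-pairs-≤ j λ x → begin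
    T i j x ℤ.+ T i j (flipAt x j)
      ≡⟨ cong (ℤ._+_ (T i j x)) (T-flipAt x) ⟩
    T i j x ℤ.+ χ i x ℤ.* pmℤ (g i (flipAt x j)) ℤ.* (pmℤ (not (lookup x j)) ℤ.* pmℤ (g j x))
      ≤⟨ pair-offDiag (lookup x i) (lookup x j) (g j x) (g i x) (g i (flipAt x j)) ⟩
    + 2 ℤ.* 𝟙 (g i x xor g i (flipAt x j)) ∎
    where
    open ℤ.≤-Reasoning
    T-flipAt : ∀ x → T i j (flipAt x j)
                     ≡ χ i x ℤ.* pmℤ (g i (flipAt x j)) ℤ.* (pmℤ (not (lookup x j)) ℤ.* pmℤ (g j x))
    T-flipAt x = trans
      (cong₂ (λ a G → pmℤ a ℤ.* pmℤ (g i (flipAt x j)) ℤ.* (χ j (flipAt x j) ℤ.* pmℤ G))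
             (lookup∘updateAt′ i j i≢j x) (cong (sgn true) (∂-flipAt j q x)))
      (cong (λ c → χ i x ℤ.* pmℤ (g i (flipAt x j)) ℤ.* (pmℤ c ℤ.* pmℤ (g j x))) (lookup∘updateAt j x))

  ∑T-bound : ∀ i j → ∑[ x ∈ allCube n ] T i j x ℤ.≤ N ℤ.* δ i j ℤ.+ sensAt (g i) j
  ∑T-bound i j with i Fin.≟ j
  ... | yes refl = begin
    ∑[ x ∈ allCube n ] T i i x    ≡⟨ ∑T-diag i ⟩
    N                             ≡⟨ trans (sym (ℤ.*-identityʳ N)) (cong (N ℤ.*_) (sym (δ-diag i))) ⟩
    N ℤ.* δ i i                   ≡⟨ ℤ.+-identityʳ (N ℤ.* δ i i) ⟨
    N ℤ.* δ i i ℤ.+ 0ℤ            ≤⟨ ℤ.+-monoʳ-≤ (N ℤ.* δ i i) (sensAt-nonNeg (g i) i) ⟩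
    N ℤ.* δ i i ℤ.+ sensAt (g i) i ∎
    where open ℤ.≤-Reasoning
  ... | no i≢j = begin
    ∑[ x ∈ allCube n ] T i j x
      ≤⟨ ∑T-offDiag i≢j ⟩
    sensAt (g i) j
      ≡⟨ ℤ.+-identityˡ (sensAt (g i) j) ⟨
    0ℤ ℤ.+ sensAt (g i) j
      ≡⟨ cong (λ t → t ℤ.+ sensAt (g i) j) (trans (sym (ℤ.*-zeroʳ N)) (cong (N ℤ.*_) (sym (δ-offDiag i≢j)))) ⟩
    N ℤ.* δ i j ℤ.+ sensAt (g i) j ∎
    where open ℤ.≤-Reasoning

  ∑A²-bound : ∑[ x ∈ allCube n ] (A x ℤ.* A x) ℤ.≤ + n ℤ.* N ℤ.+ ∑[ i ∈ allFin n ] sensℤ (g i)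
  ∑A²-bound = begin
    ∑[ x ∈ allCube n ] (A x ℤ.* A x)
      ≡⟨ ∑A²≡∑T ⟩
    ∑[ i ∈ allFin n ] ∑[ j ∈ allFin n ] ∑[ x ∈ allCube n ] T i j x
      ≤⟨ ∑-mono-≤ (allFin n) (λ i → ∑-mono-≤ (allFin n) (∑T-bound i)) ⟩
    ∑[ i ∈ allFin n ] ∑[ j ∈ allFin n ] (N ℤ.* δ i j ℤ.+ sensAt (g i) j)
      ≡⟨ ∑-cong (allFin n) (λ i → trans (∑-+ (allFin n) (λ j → N ℤ.* δ i j) (sensAt (g i)))
                                         (cong (ℤ._+ sensℤ (g i)) (∑-Nδ i))) ⟩
    ∑[ i ∈ allFin n ] (N ℤ.+ sensℤ (g i))
      ≡⟨ ∑-+ (allFin n) (λ _ → N) (λ i → sensℤ (g i)) ⟩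
    ∑[ _ ∈ allFin n ] N ℤ.+ ∑[ i ∈ allFin n ] sensℤ (g i)
      ≡⟨ cong (ℤ._+ ∑[ i ∈ allFin n ] sensℤ (g i))
              (trans (∑-const (allFin n) N) (cong (λ l → + l ℤ.* N) (length-allFin n))) ⟩
    + n ℤ.* N ℤ.+ ∑[ i ∈ allFin n ] sensℤ (g i) ∎
    where
    open ℤ.≤-Reasoning
    ∑-Nδ : ∀ i → ∑[ j ∈ allFin n ] (N ℤ.* δ i j) ≡ N
    ∑-Nδ i = trans (∑-*ˡ (allFin n) N (δ i)) (trans (cong (N ℤ.*_) (∑-δ i)) (ℤ.*-identityʳ N))

  sens²-recursionℤ : sensℤ f ℤ.* sensℤ f ℤ.≤ N ℤ.* (+ n ℤ.* N ℤ.+ ∑[ i ∈ allFin n ] sensℤ (g i))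
  sens²-recursionℤ = ℤ.≤-trans sens²≤N*∑A² (ℤ.*-monoˡ-≤-nonNeg N ∑A²-bound)

  sens²-recursion : sensCount f * sensCount f ≤
                    2 ^ n * (n * 2 ^ n + sum (map (λ i → sensCount (g i)) (allFin n)))
  sens²-recursion = ℤ.drop‿+≤+ (subst₂ ℤ._≤_ (sym lhs) (sym rhs) sens²-recursionℤ)
    where
    open ≡-Reasoning
    N≡2^n : N ≡ + 2 ^ n
    N≡2^n = cong +_ (length-allCube n)
    lhs : + (sensCount f * sensCount f) ≡ sensℤ f ℤ.* sensℤ f
    lhs = trans (ℤ.pos-* (sensCount f) (sensCount f)) (cong₂ ℤ._*_ (sensCount≡sensℤ f) (sensCount≡sensℤ f))
    rhs : + (2 ^ n * (n * 2 ^ n + sum (map (λ i → sensCount (g i)) (allFin n))))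
          ≡ N ℤ.* (+ n ℤ.* N ℤ.+ ∑[ i ∈ allFin n ] sensℤ (g i))
    rhs = begin
      + (2 ^ n * (n * 2 ^ n + sum (map (λ i → sensCount (g i)) (allFin n))))
        ≡⟨ ℤ.pos-* (2 ^ n) _ ⟩
      + 2 ^ n ℤ.* + (n * 2 ^ n + sum (map (λ i → sensCount (g i)) (allFin n)))
        ≡⟨ cong (ℤ._*_ (+ 2 ^ n)) (ℤ.pos-+ (n * 2 ^ n) _) ⟩
      + 2 ^ n ℤ.* (+ (n * 2 ^ n) ℤ.+ + sum (map (λ i → sensCount (g i)) (allFin n)))
        ≡⟨ cong₂ (λ u v → + 2 ^ n ℤ.* (u ℤ.+ v)) (ℤ.pos-* n (2 ^ n))
                 (trans (∑-pos (allFin n) (λ i → sensCount (g i)))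
                        (∑-cong (allFin n) (λ i → sensCount≡sensℤ (g i)))) ⟩
      + 2 ^ n ℤ.* (+ n ℤ.* + 2 ^ n ℤ.+ ∑[ i ∈ allFin n ] sensℤ (g i))
        ≡⟨ cong (λ t → t ℤ.* (+ n ℤ.* t ℤ.+ ∑[ i ∈ allFin n ] sensℤ (g i))) N≡2^n ⟨
      N ℤ.* (+ n ℤ.* N ℤ.+ ∑[ i ∈ allFin n ] sensℤ (g i)) ∎

^-distribʳ-* : ∀ a b k → (a * b) ^ k ≡ a ^ k * b ^ k
^-distribʳ-* a b zero    = refl
^-distribʳ-* a b (suc k) = trans (cong (a * b *_) (^-distribʳ-* a b k)) (lemma a b (a ^ k) (b ^ k))
  where
  lemma : ∀ a b x y → a * b * (x * y) ≡ a * x * (b * y)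
  lemma = ℕ.solve-∀

2^k+6^k≤9^k : ∀ k → 1 ≤ k → 2 ^ k + 6 ^ k ≤ 9 ^ k
2^k+6^k≤9^k (suc zero)    _ = ℕ.m≤m+n 8 1
2^k+6^k≤9^k (suc (suc k)) _ = begin
  2 * 2 ^ suc k + 6 * 6 ^ suc k ≤⟨ ℕ.+-mono-≤ (ℕ.*-monoˡ-≤ (2 ^ suc k) 2≤9) (ℕ.*-monoˡ-≤ (6 ^ suc k) 6≤9) ⟩
  9 * 2 ^ suc k + 9 * 6 ^ suc k ≡⟨ ℕ.*-distribˡ-+ 9 (2 ^ suc k) (6 ^ suc k) ⟨
  9 * (2 ^ suc k + 6 ^ suc k)   ≤⟨ ℕ.*-monoʳ-≤ 9 (2^k+6^k≤9^k (suc k) (s≤s z≤n)) ⟩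
  9 * 9 ^ suc k                 ∎
  where
  open ℕ.≤-Reasoning
  2≤9 : 2 ≤ 9
  2≤9 = ℕ.m≤m+n 2 7
  6≤9 : 6 ≤ 9
  6≤9 = ℕ.m≤m+n 6 3

+-^-≤ : ∀ a b k → (a + b) ^ k ≤ 2 ^ k * (a ^ k + b ^ k)
+-^-≤ a b k = begin
  (a + b) ^ k                   ≤⟨ ℕ.^-monoˡ-≤ k (ℕ.+-mono-≤ (ℕ.m≤m⊔n a b) (ℕ.m≤n⊔m a b)) ⟩
  ((a ⊔ b) + (a ⊔ b)) ^ k       ≡⟨ cong (_^ k) (double (a ⊔ b)) ⟩
  (2 * (a ⊔ b)) ^ k             ≡⟨ ^-distribʳ-* 2 (a ⊔ b) k ⟩
  2 ^ k * (a ⊔ b) ^ k           ≤⟨ ℕ.*-monoʳ-≤ (2 ^ k) max^k≤ ⟩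
  2 ^ k * (a ^ k + b ^ k)       ∎
  where
  open ℕ.≤-Reasoning
  double : ∀ c → c + c ≡ 2 * c
  double = ℕ.solve-∀
  max^k≤ : (a ⊔ b) ^ k ≤ a ^ k + b ^ k
  max^k≤ with ℕ.⊔-sel a b
  ... | inj₁ a⊔b≡a = subst (λ c → c ^ k ≤ a ^ k + b ^ k) (sym a⊔b≡a) (ℕ.m≤m+n (a ^ k) (b ^ k))
  ... | inj₂ a⊔b≡b = subst (λ c → c ^ k ≤ a ^ k + b ^ k) (sym a⊔b≡b) (ℕ.m≤n+m (b ^ k) (a ^ k))

sum-^-bound : ∀ N m c K → 1 ≤ K → 1 ≤ c → m ^ K ≤ 3 ^ K * N ^ K * c → (N + m) ^ K ≤ 9 ^ K * N ^ K * c
sum-^-bound N m c K 1≤K 1≤c m^K≤ = begin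
  (N + m) ^ K                                ≤⟨ +-^-≤ N m K ⟩
  2 ^ K * (N ^ K + m ^ K)                    ≤⟨ ℕ.*-monoʳ-≤ (2 ^ K) (ℕ.+-mono-≤ N^K≤ m^K≤) ⟩
  2 ^ K * (N ^ K * c + 3 ^ K * N ^ K * c)    ≡⟨ lemma (2 ^ K) (3 ^ K) (N ^ K) c ⟩
  (2 ^ K + 2 ^ K * 3 ^ K) * N ^ K * c        ≡⟨ cong (λ t → (2 ^ K + t) * N ^ K * c) (^-distribʳ-* 2 3 K) ⟨
  (2 ^ K + 6 ^ K) * N ^ K * c                ≤⟨ ℕ.*-monoˡ-≤ c (ℕ.*-monoˡ-≤ (N ^ K) (2^k+6^k≤9^k K 1≤K)) ⟩
  9 ^ K * N ^ K * c                          ∎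
  where
  open ℕ.≤-Reasoning
  N^K≤ : N ^ K ≤ N ^ K * c
  N^K≤ = subst (_≤ N ^ K * c) (ℕ.*-identityʳ (N ^ K)) (ℕ.*-monoʳ-≤ (N ^ K) 1≤c)
  lemma : ∀ t s a c → t * (a * c + s * a * c) ≡ (t + t * s) * a * c
  lemma = ℕ.solve-∀

n*n≡0⇒n≡0 : ∀ n → n * n ≡ 0 → n ≡ 0
n*n≡0⇒n≡0 n n*n≡0 with ℕ.m*n≡0⇒m≡0∨n≡0 n n*n≡0
... | inj₁ n≡0 = n≡0
... | inj₂ n≡0 = n≡0

square-recursion-bound : ∀ N n K S m → 1 ≤ K → m ^ K ≤ 3 ^ K * N ^ K * n ^ (K ∸ 1) →
  S * S ≤ N * (n * N + n * m) → S ^ (2 * K) ≤ 3 ^ (2 * K) * N ^ (2 * K) * n ^ (2 * K ∸ 1)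
square-recursion-bound N zero (suc K′) S m _ _ S²≤0
  rewrite n*n≡0⇒n≡0 S (ℕ.n≤0⇒n≡0 (subst (S * S ≤_) (ℕ.*-zeroʳ N) S²≤0)) = z≤n
square-recursion-bound N (suc n′) K@(suc K′) S m _ m^K≤ S²≤ = begin
  S ^ (2 * K)
    ≡⟨ ℕ.^-*-assoc S 2 K ⟨
  (S * (S * 1)) ^ K
    ≡⟨ cong (λ t → (S * t) ^ K) (ℕ.*-identityʳ S) ⟩
  (S * S) ^ K
    ≤⟨ ℕ.^-monoˡ-≤ K S²≤ ⟩
  (N * (n * N + n * m)) ^ K
    ≡⟨ cong (_^ K) (lemma₁ N n m) ⟩
  (n * N * (N + m)) ^ K
    ≡⟨ trans (^-distribʳ-* (n * N) (N + m) K) (cong (_* (N + m) ^ K) (^-distribʳ-* n N K)) ⟩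
  n ^ K * N ^ K * (N + m) ^ K
    ≤⟨ ℕ.*-monoʳ-≤ (n ^ K * N ^ K) (sum-^-bound N m (n ^ K′) K (s≤s z≤n) (ℕ.m^n>0 n K′) m^K≤) ⟩
  n ^ K * N ^ K * (9 ^ K * N ^ K * n ^ K′)
    ≡⟨ lemma₂ (n ^ K) (N ^ K) (9 ^ K) (n ^ K′) ⟩
  9 ^ K * (N ^ K * N ^ K) * (n ^ K * n ^ K′)
    ≡⟨ cong₂ (λ u v → u * v * (n ^ K * n ^ K′)) (ℕ.^-*-assoc 3 2 K) N^K*N^K ⟩
  3 ^ (2 * K) * N ^ (2 * K) * (n ^ K * n ^ K′)
    ≡⟨ cong (3 ^ (2 * K) * N ^ (2 * K) *_) (sym (ℕ.^-distribˡ-+-* n K K′)) ⟩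
  3 ^ (2 * K) * N ^ (2 * K) * n ^ (K + K′)
    ≡⟨ cong (λ e → 3 ^ (2 * K) * N ^ (2 * K) * n ^ e) (exponent K′) ⟩
  3 ^ (2 * K) * N ^ (2 * K) * n ^ (2 * K ∸ 1) ∎
  where
  open ℕ.≤-Reasoning
  n = suc n′
  lemma₁ : ∀ N n m → N * (n * N + n * m) ≡ n * N * (N + m)
  lemma₁ = ℕ.solve-∀
  lemma₂ : ∀ a b t c → a * b * (t * b * c) ≡ t * (b * b) * (a * c)
  lemma₂ = ℕ.solve-∀
  N^K*N^K : N ^ K * N ^ K ≡ N ^ (2 * K)
  N^K*N^K = trans (sym (ℕ.^-distribˡ-+-* N K K)) (cong (λ e → N ^ (K + e)) (sym (ℕ.+-identityʳ K)))
  exponent : ∀ k → suc k + k ≡ k + (suc k + 0)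
  exponent = ℕ.solve-∀

sum≤length*bound : ∀ {m} (xs : List ℕ) → All (_≤ m) xs → sum xs ≤ length xs * m
sum≤length*bound []       []           = z≤n
sum≤length*bound (x ∷ xs) (x≤m ∷ xs≤m) = ℕ.+-mono-≤ x≤m (sum≤length*bound xs xs≤m)

max^k≤ : ∀ {k B} (xs : List ℕ) → 1 ≤ k → All (λ x → x ^ k ≤ B) xs → max 0 xs ^ k ≤ B
max^k≤ {suc k} xs _ xs^k≤B with argmax-sel id 0 xs
... | inj₁ max≡0  = subst (λ x → x ^ suc k ≤ _) (sym max≡0) z≤n
... | inj₂ max∈xs = All.lookup xs^k≤B max∈xs

sensCount-const : ∀ {n} (φ : Cube n → Bool) → (∀ x y → φ x ≡ φ y) → sensCount φ ≡ 0
sensCount-const {n} φ φ-const = ℤ.+-injective (begin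
  + sensCount φ
    ≡⟨ sensCount≡sensℤ φ ⟩
  ∑[ i ∈ allFin n ] ∑[ x ∈ allCube n ] 𝟙 (φ x xor φ (flipAt x i))
    ≡⟨ ∑-cong (allFin n) (λ i → ∑-cong (allCube n) (λ x → no-change i x)) ⟩
  ∑[ i ∈ allFin n ] ∑[ x ∈ allCube n ] 0ℤ
    ≡⟨ ∑-cong (allFin n) (λ i → ∑-zero (allCube n)) ⟩
  ∑[ i ∈ allFin n ] 0ℤ
    ≡⟨ ∑-zero (allFin n) ⟩
  0ℤ ∎)
  where
  open ≡-Reasoning
  no-change : ∀ i x → 𝟙 (φ x xor φ (flipAt x i)) ≡ 0ℤ
  no-change i x = cong 𝟙 (trans (cong (φ x xor_) (φ-const (flipAt x i) x)) (xor-same (φ x)))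

sensitivity-bound : ∀ d {n} (q : Cube n → ℚ) b → HasDegree≤ d q →
  sensCount (λ x → sgn b (q x)) ^ (2 ^ d) ≤ 3 ^ (2 ^ d) * (2 ^ n) ^ (2 ^ d) * n ^ (2 ^ d ∸ 1)
sensitivity-bound zero    q b q-const =
  subst (λ s → s ^ 1 ≤ _) (sym (sensCount-const _ λ x y → cong (sgn b) (q-const x y))) z≤n
sensitivity-bound (suc d) {n} q b q-deg =
  square-recursion-bound (2 ^ n) n K (sensCount f) (max 0 ss) 1≤K max^K≤
    (ℕ.≤-trans sens²-recursion (ℕ.*-monoʳ-≤ (2 ^ n) (ℕ.+-monoʳ-≤ (n * 2 ^ n) sum≤n*max)))
  where
  open SensitivityRecursion q b
  K = 2 ^ d
  1≤K : 1 ≤ K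
  1≤K = ℕ.m^n>0 2 d
  ss : List ℕ
  ss = map (λ i → sensCount (g i)) (allFin n)
  max^K≤ : max 0 ss ^ K ≤ 3 ^ K * (2 ^ n) ^ K * n ^ (K ∸ 1)
  max^K≤ = max^k≤ ss 1≤K (All.map⁺ (All.tabulate⁺ λ i → sensitivity-bound d (∂ i q) true (q-deg i)))
  sum≤n*max : sum ss ≤ n * max 0 ss
  sum≤n*max = subst (λ l → sum ss ≤ l * max 0 ss) (trans (length-map _ (allFin n)) (length-allFin n))
                (sum≤length*bound ss (xs≤max 0 ss))

-- The bound holds for d = 0 too, where f is constant.
mainTheorem15 : (d : ℕ) → 1 ≤ d → (n : ℕ) → (b : Bool) → (P : Poly n) → DegreeAtMost d P →
    sensCount (ptf b P) ^ (2 ^ d) ≤ (3 ^ (2 ^ d)) * ((2 ^ n) ^ (2 ^ d)) * (n ^ (2 ^ d ∸ 1))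
mainTheorem15 d _ n b P P≤d = sensitivity-bound d (evalPoly P) b (evalPoly-degree d P P≤d)
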